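{- Let $f_1(m,n)$ and $f_2(m,n)$ be linearly independent homogeneous quadratic polynomials with integer coefficients, and let $k_1,k_2$ be integers with $(k_1,k_2)\neq(0,0)$. Then the system $f_1(m,n)=k_1$, $f_2(m,n)=k_2$ has only finitely many integer solutions $(m,n)$. -}

module Defs where

open import Data.Integer using (ℤ; _+_; _*_; 0ℤ)
open import Data.Product using (_×_; _,_; Σ)
open import Data.List using (List)
open import Data.List.Membership.Propositional using (_∈_)
open import Relation.Binary.PropositionalEquality using (_≡_)

record BinQuad : Set where
  constructor quad
  field
    a b c : ℤ

open BinQuad public

eval : BinQuad → ℤ → ℤ → ℤ
eval (quad a b c) m n = a * m * m + b * m * n + c * n * n

-- Linear independence of f₁, f₂ (as polynomials, over ℤ; equivalent to
-- over ℚ by clearing denominators): the only integer relation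
-- λ f₁ + μ f₂ = 0 (coefficientwise) is the trivial one.
LinIndep : BinQuad → BinQuad → Set
LinIndep f₁ f₂ =
  ∀ (λ₁ μ : ℤ) →
  λ₁ * a f₁ + μ * a f₂ ≡ 0ℤ →
  λ₁ * b f₁ + μ * b f₂ ≡ 0ℤ →
  λ₁ * c f₁ + μ * c f₂ ≡ 0ℤ →
  (λ₁ ≡ 0ℤ) × (μ ≡ 0ℤ)

FinitelyMany : (ℤ → ℤ → Set) → Set
FinitelyMany P = Σ (List (ℤ × ℤ)) λ xs → ∀ m n → P m n → (m , n) ∈ xs

{-# OPTIONS --safe #-}
-- Let w = (α , β , γ) be the cross product of the coefficient vectors of f₁ and f₂ (nonzero by
-- independence) and q = k₁ f₂ − k₂ f₁, a nonzero form vanishing at every solution.  The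
-- combinations a₂ f₁ − a₁ f₂ and b₂ f₁ − b₁ f₂, evaluated at a solution, give the coefficients
-- q₁ = β n² − γ m n and q₂ = γ m² − α n² of q; eliminating m yields
--   (β² − α γ) n⁴ − (2 β q₁ + γ q₂) n² + q₁² = 0.
-- Unless this polynomial is identically zero it bounds n²; if it is, then γ = 0 ≠ α and
-- q₂ = − α n² bounds n².  Exchanging m and n bounds m, so all solutions lie in a finite box.
module Submission where

open import Algebra.Bundles using (AbelianGroup)
open import Data.Empty using (⊥-elim)
open import Data.Integer using (ℤ; +_; -[1+_]; 0ℤ; 1ℤ; ∣_∣; _+_; _*_; -_; _-_; _≟_)
import Data.Integer as ℤ
open import Data.Integer.Properties
  using (abs-*; ∣-i∣≡∣i∣; ∣i+j∣≤∣i∣+∣j∣; +-identityˡ; +-assoc; +-inverseʳ; +-0-abelianGroup;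
         i*j≡0⇒i≡0∨j≡0; neg-injective; i-j≡0⇒i≡j; i≡j⇒i-j≡0)
open import Data.Integer.Tactic.RingSolver using (solve; solve-∀)
open import Data.List using (List; []; _∷_; cartesianProduct)
open import Data.List.Membership.Propositional using (_∈_)
open import Data.List.Membership.Propositional.Properties using (∈-cartesianProduct⁺)
open import Data.List.Relation.Unary.Any using (here; there)
open import Data.Nat as ℕ using (ℕ; zero; suc; z≤n; s≤s; _≤_; NonZero)
open import Data.Nat.Properties
  using (≤-trans; ≤-reflexive; m≤n*m; m≤m*n; m≤m+n; m≤n+m; m≤n⇒m<n∨m≡n; +-monoʳ-≤;
         *-distribʳ-+; *-cancelʳ-≤; module ≤-Reasoning)
open import Data.Product using (_×_; _,_; proj₁; proj₂)
open import Data.Sum using (inj₁; inj₂; reduce; [_,_]′)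
open import Relation.Binary.PropositionalEquality
  using (_≡_; _≢_; refl; sym; trans; cong; module ≡-Reasoning)
open import Relation.Nullary using (¬_; Dec; yes; no; contradiction)
open import Relation.Nullary.Decidable using (_×-dec_)

open import Algebra.Properties.Group (AbelianGroup.group +-0-abelianGroup) using (inverseˡ-unique)
open import Defs

a*x*x≤b*x+d⇒x≤b+d : ∀ a b d x .{{_ : NonZero a}} → a ℕ.* (x ℕ.* x) ≤ b ℕ.* x ℕ.+ d → x ≤ b ℕ.+ d
a*x*x≤b*x+d⇒x≤b+d a b d zero      _ = z≤n
a*x*x≤b*x+d⇒x≤b+d a b d x@(suc _) h = *-cancelʳ-≤ x (b ℕ.+ d) x (begin
  x ℕ.* x                 ≤⟨ m≤n*m (x ℕ.* x) a ⟩
  a ℕ.* (x ℕ.* x)         ≤⟨ h ⟩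
  b ℕ.* x ℕ.+ d           ≤⟨ +-monoʳ-≤ (b ℕ.* x) (m≤m*n d x) ⟩
  b ℕ.* x ℕ.+ d ℕ.* x     ≡⟨ *-distribʳ-+ x b d ⟨
  (b ℕ.+ d) ℕ.* x         ∎)
  where open ≤-Reasoning

∣i∣≤∣j*i∣ : ∀ {i j} → j ≢ 0ℤ → ∣ i ∣ ≤ ∣ j * i ∣
∣i∣≤∣j*i∣ {i} {j} j≢0 = ≤-trans (m≤n*m ∣ i ∣ ∣ j ∣ {{ℤ.≢-nonZero j≢0}}) (≤-reflexive (sym (abs-* j i)))

∣i∣≤∣i*i∣ : ∀ i → ∣ i ∣ ≤ ∣ i * i ∣
∣i∣≤∣i*i∣ i with i ≟ 0ℤ
... | yes refl = z≤n
... | no i≢0   = ∣i∣≤∣j*i∣ i≢0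

i*i≡0⇒i≡0 : ∀ i → i * i ≡ 0ℤ → i ≡ 0ℤ
i*i≡0⇒i≡0 i eq = reduce (i*j≡0⇒i≡0∨j≡0 i eq)

i*j≡0⇒j≡0 : ∀ {i j} → i ≢ 0ℤ → i * j ≡ 0ℤ → j ≡ 0ℤ
i*j≡0⇒j≡0 {i} i≢0 eq = [ (λ i≡0 → contradiction i≡0 i≢0) , (λ j≡0 → j≡0) ]′ (i*j≡0⇒i≡0∨j≡0 i eq)

quadratic-root-bound : ∀ c₂ c₁ c₀ x → ¬ (c₂ ≡ 0ℤ × c₁ ≡ 0ℤ × c₀ ≡ 0ℤ) →
                       c₂ * (x * x) + c₁ * x + c₀ ≡ 0ℤ → ∣ x ∣ ≤ ∣ c₁ ∣ ℕ.+ ∣ c₀ ∣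
quadratic-root-bound c₂ c₁ c₀ x nonzero root with c₂ ≟ 0ℤ | c₁ ≟ 0ℤ
... | no c₂≢0 | _ = a*x*x≤b*x+d⇒x≤b+d (∣ c₂ ∣) (∣ c₁ ∣) (∣ c₀ ∣) (∣ x ∣) {{ℤ.≢-nonZero c₂≢0}} (begin
  ∣ c₂ ∣ ℕ.* (∣ x ∣ ℕ.* ∣ x ∣)  ≡⟨ cong (∣ c₂ ∣ ℕ.*_) (abs-* x x) ⟨
  ∣ c₂ ∣ ℕ.* ∣ x * x ∣          ≡⟨ abs-* c₂ (x * x) ⟨
  ∣ c₂ * (x * x) ∣              ≡⟨ cong ∣_∣ c₂x²≡-[c₁x+c₀] ⟩
  ∣ - (c₁ * x + c₀) ∣           ≡⟨ ∣-i∣≡∣i∣ (c₁ * x + c₀) ⟩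
  ∣ c₁ * x + c₀ ∣               ≤⟨ ∣i+j∣≤∣i∣+∣j∣ (c₁ * x) c₀ ⟩
  ∣ c₁ * x ∣ ℕ.+ ∣ c₀ ∣         ≡⟨ cong (ℕ._+ ∣ c₀ ∣) (abs-* c₁ x) ⟩
  ∣ c₁ ∣ ℕ.* ∣ x ∣ ℕ.+ ∣ c₀ ∣   ∎)
  where
  open ≤-Reasoning
  c₂x²≡-[c₁x+c₀] : c₂ * (x * x) ≡ - (c₁ * x + c₀)
  c₂x²≡-[c₁x+c₀] = inverseˡ-unique (c₂ * (x * x)) (c₁ * x + c₀)
    (trans (sym (+-assoc (c₂ * (x * x)) (c₁ * x) c₀)) root)
... | yes refl | no c₁≢0 = begin
  ∣ x ∣               ≤⟨ ∣i∣≤∣j*i∣ c₁≢0 ⟩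
  ∣ c₁ * x ∣          ≡⟨ cong ∣_∣ c₁x≡-c₀ ⟩
  ∣ - c₀ ∣            ≡⟨ ∣-i∣≡∣i∣ c₀ ⟩
  ∣ c₀ ∣              ≤⟨ m≤n+m ∣ c₀ ∣ ∣ c₁ ∣ ⟩
  ∣ c₁ ∣ ℕ.+ ∣ c₀ ∣   ∎
  where
  open ≤-Reasoning
  c₁x≡-c₀ : c₁ * x ≡ - c₀
  c₁x≡-c₀ = inverseˡ-unique (c₁ * x) c₀ (trans (cong (_+ c₀) (sym (+-identityˡ (c₁ * x)))) root)
... | yes refl | yes refl = ⊥-elim (nonzero (refl , refl , trans (sym (+-identityˡ c₀)) root))

IsZero : BinQuad → Set
IsZero f = (a f ≡ 0ℤ) × (b f ≡ 0ℤ) × (c f ≡ 0ℤ)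

isZero? : ∀ f → Dec (IsZero f)
isZero? f = (a f ≟ 0ℤ) ×-dec (b f ≟ 0ℤ) ×-dec (c f ≟ 0ℤ)

lin : ℤ → BinQuad → ℤ → BinQuad → BinQuad
lin s f t g = quad (s * a f + t * a g) (s * b f + t * b g) (s * c f + t * c g)

minor : (BinQuad → ℤ) → (BinQuad → ℤ) → BinQuad → BinQuad → ℤ
minor x y f g = x f * y g - y f * x g

cross : BinQuad → BinQuad → BinQuad
cross f g = quad (minor b c f g) (minor c a f g) (minor a b f g)

dot : BinQuad → BinQuad → ℤ
dot f g = a f * a g + b f * b g + c f * c g

dot-cross-lin≡0 : ∀ f g s t → dot (cross f g) (lin s f t g) ≡ 0ℤ
dot-cross-lin≡0 (quad a₁ b₁ c₁) (quad a₂ b₂ c₂) s t = begin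
  dot (cross (quad a₁ b₁ c₁) (quad a₂ b₂ c₂)) (lin s (quad a₁ b₁ c₁) t (quad a₂ b₂ c₂)) ≡⟨⟩
  (b₁ * c₂ - c₁ * b₂) * (s * a₁ + t * a₂) + (c₁ * a₂ - a₁ * c₂) * (s * b₁ + t * b₂)
    + (a₁ * b₂ - b₁ * a₂) * (s * c₁ + t * c₂)                   ≡⟨ solve (a₁ ∷ b₁ ∷ c₁ ∷ a₂ ∷ b₂ ∷ c₂ ∷ s ∷ t ∷ []) ⟩
  0ℤ                                                           ∎
  where open ≡-Reasoning

minor-diagonal : ∀ x f g → minor x x f g ≡ 0ℤ
minor-diagonal x f g = +-inverseʳ (x f * x g)

minor-antisym : ∀ x y f g → minor y x f g ≡ 0ℤ → minor x y f g ≡ 0ℤ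
minor-antisym x y f g eq = i≡j⇒i-j≡0 (sym (i-j≡0⇒i≡j (y f * x g) (x f * y g) eq))

minor-combination : ∀ x y f g → (- x g) * y f + x f * y g ≡ minor x y f g
minor-combination x y f g = minor-coordinate (x f) (x g) (y f) (y g)
  where
  minor-coordinate : ∀ x₁ x₂ y₁ y₂ → (- x₂) * y₁ + x₁ * y₂ ≡ x₁ * y₂ - y₁ * x₂
  minor-coordinate = solve-∀

cross-nonzero : ∀ {f g} → LinIndep f g → ¬ IsZero (cross f g)
cross-nonzero {f} {g} indep (α≡0 , β≡0 , γ≡0) =
  contradiction (proj₁ (indep 1ℤ 0ℤ (only a≡0) (only b≡0) (only c≡0))) λ ()
  where
  -- if all minors vanish, (− x g) f + (x f) g = 0 for every coordinate x, so f = 0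
  coordinate≡0 : ∀ x → minor x a f g ≡ 0ℤ → minor x b f g ≡ 0ℤ → minor x c f g ≡ 0ℤ → x f ≡ 0ℤ
  coordinate≡0 x ea eb ec = proj₂ (indep (- x g) (x f)
    (trans (minor-combination x a f g) ea)
    (trans (minor-combination x b f g) eb)
    (trans (minor-combination x c f g) ec))

  a≡0 : a f ≡ 0ℤ
  a≡0 = coordinate≡0 a (minor-diagonal a f g) γ≡0 (minor-antisym a c f g β≡0)

  b≡0 : b f ≡ 0ℤ
  b≡0 = coordinate≡0 b (minor-antisym b a f g γ≡0) (minor-diagonal b f g) α≡0

  c≡0 : c f ≡ 0ℤ
  c≡0 = coordinate≡0 c β≡0 (minor-antisym c b f g α≡0) (minor-diagonal c f g)

  only : ∀ {x} → x ≡ 0ℤ → 1ℤ * x + 0ℤ ≡ 0ℤ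
  only refl = refl

vanishingForm : BinQuad → BinQuad → ℤ → ℤ → BinQuad
vanishingForm f₁ f₂ k₁ k₂ = lin (- k₂) f₁ k₁ f₂

vanishingForm-nonzero : ∀ {f₁ f₂ k₁ k₂} → LinIndep f₁ f₂ → ¬ (k₁ ≡ 0ℤ × k₂ ≡ 0ℤ) →
                        ¬ IsZero (vanishingForm f₁ f₂ k₁ k₂)
vanishingForm-nonzero {k₁ = k₁} {k₂} indep k≢0 (ea , eb , ec) with indep (- k₂) k₁ ea eb ec
... | -k₂≡0 , k₁≡0 = k≢0 (k₁≡0 , neg-injective -k₂≡0)

vanishingForm-a : ∀ f g m n {k₁ k₂} → eval f m n ≡ k₁ → eval g m n ≡ k₂ →
                  a (vanishingForm f g k₁ k₂) ≡ b (cross f g) * (n * n) - c (cross f g) * (m * n)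
vanishingForm-a (quad a₁ b₁ c₁) (quad a₂ b₂ c₂) m n refl refl = begin
  (- (a₂ * m * m + b₂ * m * n + c₂ * n * n)) * a₁ + (a₁ * m * m + b₁ * m * n + c₁ * n * n) * a₂
    ≡⟨ solve (a₁ ∷ b₁ ∷ c₁ ∷ a₂ ∷ b₂ ∷ c₂ ∷ m ∷ n ∷ []) ⟩
  (c₁ * a₂ - a₁ * c₂) * (n * n) - (a₁ * b₂ - b₁ * a₂) * (m * n) ∎
  where open ≡-Reasoning

vanishingForm-b : ∀ f g m n {k₁ k₂} → eval f m n ≡ k₁ → eval g m n ≡ k₂ →
                  b (vanishingForm f g k₁ k₂) ≡ c (cross f g) * (m * m) - a (cross f g) * (n * n)
vanishingForm-b (quad a₁ b₁ c₁) (quad a₂ b₂ c₂) m n refl refl = begin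
  (- (a₂ * m * m + b₂ * m * n + c₂ * n * n)) * b₁ + (a₁ * m * m + b₁ * m * n + c₁ * n * n) * b₂
    ≡⟨ solve (a₁ ∷ b₁ ∷ c₁ ∷ a₂ ∷ b₂ ∷ c₂ ∷ m ∷ n ∷ []) ⟩
  (a₁ * b₂ - b₁ * a₂) * (m * m) - (b₁ * c₂ - c₁ * b₂) * (n * n) ∎
  where open ≡-Reasoning

eliminant : BinQuad → BinQuad → BinQuad
eliminant w q = quad (b w * b w - a w * c w) (- ((+ 2) * b w * a q + c w * b q)) (a q * a q)

-- Square γ m n = β n² − q₁ and substitute γ m² = q₂ + α n².
eliminate-m : ∀ α β γ q₁ q₂ m n → q₁ ≡ β * (n * n) - γ * (m * n) → q₂ ≡ γ * (m * m) - α * (n * n) →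
  (β * β - α * γ) * ((n * n) * (n * n)) + (- ((+ 2) * β * q₁ + γ * q₂)) * (n * n) + q₁ * q₁ ≡ 0ℤ
eliminate-m α β γ _ _ m n refl refl = solve (α ∷ β ∷ γ ∷ m ∷ n ∷ [])

eliminant-degenerate : ∀ {w q} → ¬ IsZero w → ¬ IsZero q → dot w q ≡ 0ℤ →
                       IsZero (eliminant w q) → c w ≡ 0ℤ × a w ≢ 0ℤ
eliminant-degenerate {quad α β γ} {quad q₁ q₂ q₃} w≢0 q≢0 w·q≡0 (A≡0 , B≡0 , C≡0)
  with i*i≡0⇒i≡0 q₁ C≡0 | γ ≟ 0ℤ
... | refl | yes refl = refl , λ α≡0 → w≢0 (α≡0 , i*i≡0⇒i≡0 β β²≡0 , refl)
  where
  open ≡-Reasoning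
  β²≡0 : β * β ≡ 0ℤ
  β²≡0 = begin
    β * β           ≡⟨ solve (α ∷ β ∷ []) ⟩
    β * β - α * 0ℤ  ≡⟨ A≡0 ⟩
    0ℤ              ∎
... | refl | no γ≢0 = contradiction (refl , q₂≡0 , q₃≡0) q≢0
  where
  open ≡-Reasoning
  q₂≡0 : q₂ ≡ 0ℤ
  q₂≡0 = i*j≡0⇒j≡0 γ≢0 (begin
    γ * q₂                            ≡⟨ solve (β ∷ γ ∷ q₂ ∷ []) ⟩
    - (- ((+ 2) * β * 0ℤ + γ * q₂))   ≡⟨ cong -_ B≡0 ⟩
    0ℤ                                ∎)
  q₃≡0 : q₃ ≡ 0ℤ
  q₃≡0 = i*j≡0⇒j≡0 γ≢0 (begin
    γ * q₃                        ≡⟨ solve (α ∷ β ∷ γ ∷ q₃ ∷ []) ⟩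
    α * 0ℤ + β * 0ℤ + γ * q₃      ≡⟨ cong (λ x → α * 0ℤ + β * x + γ * q₃) q₂≡0 ⟨
    α * 0ℤ + β * q₂ + γ * q₃      ≡⟨ w·q≡0 ⟩
    0ℤ                            ∎)

bound : BinQuad → BinQuad → ℤ → ℤ → ℕ
bound f₁ f₂ k₁ k₂ = ∣ b P ∣ ℕ.+ ∣ c P ∣ ℕ.+ ∣ b q ∣
  where
  q P : BinQuad
  q = vanishingForm f₁ f₂ k₁ k₂
  P = eliminant (cross f₁ f₂) q

∣n∣≤bound : ∀ {f₁ f₂ k₁ k₂} m n → LinIndep f₁ f₂ → ¬ (k₁ ≡ 0ℤ × k₂ ≡ 0ℤ) →
            eval f₁ m n ≡ k₁ → eval f₂ m n ≡ k₂ → ∣ n ∣ ≤ bound f₁ f₂ k₁ k₂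
∣n∣≤bound {f₁} {f₂} {k₁} {k₂} m n indep k≢0 e₁ e₂ = ≤-trans (∣i∣≤∣i*i∣ n) ∣n²∣≤bound
  where
  w q P : BinQuad
  w = cross f₁ f₂
  q = vanishingForm f₁ f₂ k₁ k₂
  P = eliminant w q

  N : ℤ
  N = n * n

  P[N]≡0 : a P * (N * N) + b P * N + c P ≡ 0ℤ
  P[N]≡0 = eliminate-m (a w) (b w) (c w) (a q) (b q) m n
    (vanishingForm-a f₁ f₂ m n e₁ e₂) (vanishingForm-b f₁ f₂ m n e₁ e₂)

  ∣N∣≤∣bq∣ : c w ≡ 0ℤ → a w ≢ 0ℤ → ∣ N ∣ ≤ ∣ b q ∣
  ∣N∣≤∣bq∣ γ≡0 α≢0 = begin
    ∣ N ∣              ≤⟨ ∣i∣≤∣j*i∣ {N} α≢0 ⟩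
    ∣ a w * N ∣        ≡⟨ ∣-i∣≡∣i∣ (a w * N) ⟨
    ∣ - (a w * N) ∣    ≡⟨ cong ∣_∣ bq≡-αN ⟨
    ∣ b q ∣            ∎
    where
    open ≤-Reasoning
    bq≡-αN : b q ≡ - (a w * N)
    bq≡-αN = trans (vanishingForm-b f₁ f₂ m n e₁ e₂)
      (trans (cong (λ γ → γ * (m * m) - a w * N) γ≡0) (+-identityˡ (- (a w * N))))

  ∣n²∣≤bound : ∣ N ∣ ≤ ∣ b P ∣ ℕ.+ ∣ c P ∣ ℕ.+ ∣ b q ∣
  ∣n²∣≤bound with isZero? P
  ... | no P≢0 = ≤-trans (quadratic-root-bound (a P) (b P) (c P) N P≢0 P[N]≡0)
                         (m≤m+n (∣ b P ∣ ℕ.+ ∣ c P ∣) ∣ b q ∣)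
  ... | yes P≡0 with eliminant-degenerate (cross-nonzero indep) (vanishingForm-nonzero indep k≢0)
                                          (dot-cross-lin≡0 f₁ f₂ (- k₂) k₁) P≡0
  ...   | γ≡0 , α≢0 = ≤-trans (∣N∣≤∣bq∣ γ≡0 α≢0) (m≤n+m ∣ b q ∣ (∣ b P ∣ ℕ.+ ∣ c P ∣))

swap : BinQuad → BinQuad
swap f = quad (c f) (b f) (a f)

eval-swap : ∀ f m n → eval (swap f) n m ≡ eval f m n
eval-swap (quad a₀ b₀ c₀) m n = begin
  c₀ * n * n + b₀ * n * m + a₀ * m * m  ≡⟨ solve (a₀ ∷ b₀ ∷ c₀ ∷ m ∷ n ∷ []) ⟩
  a₀ * m * m + b₀ * m * n + c₀ * n * n  ∎
  where open ≡-Reasoning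

LinIndep-swap : ∀ {f g} → LinIndep f g → LinIndep (swap f) (swap g)
LinIndep-swap indep s t ea eb ec = indep s t ec eb ea

range : ℕ → List ℤ
range zero    = 0ℤ ∷ []
range (suc t) = + suc t ∷ -[1+ t ] ∷ range t

∈-range : ∀ t z → ∣ z ∣ ≤ t → z ∈ range t
∈-range zero    (+ zero) _ = here refl
∈-range (suc t) z ∣z∣≤1+t with m≤n⇒m<n∨m≡n ∣z∣≤1+t
... | inj₁ (s≤s ∣z∣≤t) = there (there (∈-range t z ∣z∣≤t))
∈-range (suc t) (+ _)    _ | inj₂ refl = here refl
∈-range (suc t) -[1+ _ ] _ | inj₂ refl = there (here refl)

theorem2 : (f₁ f₂ : BinQuad) → LinIndep f₁ f₂ → (k₁ k₂ : ℤ) → ¬ ((k₁ ≡ 0ℤ) × (k₂ ≡ 0ℤ)) → FinitelyMany (λ m n → (eval f₁ m n ≡ k₁) × (eval f₂ m n ≡ k₂))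
theorem2 f₁ f₂ indep k₁ k₂ k≢0 = cartesianProduct (range T) (range T) , solutions∈box
  where
  Bₙ Bₘ T : ℕ
  Bₙ = bound f₁ f₂ k₁ k₂
  Bₘ = bound (swap f₁) (swap f₂) k₁ k₂
  T = Bₙ ℕ.+ Bₘ

  solutions∈box : ∀ m n → (eval f₁ m n ≡ k₁) × (eval f₂ m n ≡ k₂) →
                  (m , n) ∈ cartesianProduct (range T) (range T)
  solutions∈box m n (e₁ , e₂) = ∈-cartesianProduct⁺ (∈-range T m ∣m∣≤T) (∈-range T n ∣n∣≤T)
    where
    ∣n∣≤T : ∣ n ∣ ≤ T
    ∣n∣≤T = ≤-trans (∣n∣≤bound m n indep k≢0 e₁ e₂) (m≤m+n Bₙ Bₘ)
    ∣m∣≤T : ∣ m ∣ ≤ T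
    ∣m∣≤T = ≤-trans (∣n∣≤bound n m (LinIndep-swap indep) k≢0
                                (trans (eval-swap f₁ m n) e₁) (trans (eval-swap f₂ m n) e₂))
                    (m≤n+m Bₘ Bₙ)
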